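{- Let $n\ge 7$. For distinct leader permutations $\pi,\psi$ of length $n$, the set of permutations in $S_n$ adjacent to $\pi$ is disjoint from the set of permutations in $S_n$ adjacent to $\psi$.
   Context: Permutations are written in one-line notation; entries are called letters. A leader permutation of length $n$ is a permutation $a_1a_2\cdots a_n\in S_n$ such that for some integer $k\in[2,n]$, $a_i=k-i$ for all $1\le i<k$ and $a_i=n+k-i$ for all $k\le i\le n$. Two permutations $\pi,\rho\in S_n$ are adjacent if neither begins with $n$ or ends with $1$, and $\pi$ is obtained from $\rho$ by swapping the positions of two letters $x,y$ with $|x-y|\notin\{1,n-1\}$. -}

module Defs where

open import Data.Nat using (ℕ; _+_; _∸_; _≤_; _<_; ∣_-_∣)
open import Data.Fin using (Fin; toℕ)
open import Data.Vec using (Vec; lookup; _[_]≔_)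
open import Data.Product using (Σ; _×_)
open import Relation.Binary.PropositionalEquality using (_≡_; _≢_)
open import Relation.Nullary using (¬_)

-- A permutation of length n in one-line notation: a word a₁⋯aₙ (a Vec ℕ n,
-- position p = toℕ i + 1) whose letters are exactly 1,…,n.
IsPerm : {n : ℕ} → Vec ℕ n → Set
IsPerm {n} a =
  ((i : Fin n) → (1 ≤ lookup a i) × (lookup a i ≤ n)) ×
  ((i j : Fin n) → lookup a i ≡ lookup a j → i ≡ j)

IsLeader : {n : ℕ} → Vec ℕ n → Set
IsLeader {n} a = IsPerm a × Σ ℕ λ k → (2 ≤ k) × (k ≤ n) ×
  ((i : Fin n) →
     (toℕ i + 1 < k → lookup a i ≡ k ∸ (toℕ i + 1)) ×
     (k ≤ toℕ i + 1 → lookup a i ≡ n + k ∸ (toℕ i + 1)))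

BeginsWith : {n : ℕ} → Vec ℕ n → ℕ → Set
BeginsWith {n} a x = Σ (Fin n) λ i → (toℕ i ≡ 0) × (lookup a i ≡ x)

EndsWith : {n : ℕ} → Vec ℕ n → ℕ → Set
EndsWith {n} a x = Σ (Fin n) λ i → (toℕ i + 1 ≡ n) × (lookup a i ≡ x)

SwapOf : {n : ℕ} → Vec ℕ n → Vec ℕ n → Set
SwapOf {n} π ρ = Σ (Fin n) λ i → Σ (Fin n) λ j →
  (i ≢ j) ×
  (¬ (∣ lookup ρ i - lookup ρ j ∣ ≡ 1)) ×
  (¬ (∣ lookup ρ i - lookup ρ j ∣ ≡ n ∸ 1)) ×
  (π ≡ (ρ [ i ]≔ lookup ρ j) [ j ]≔ lookup ρ i)

Adjacent : {n : ℕ} → Vec ℕ n → Vec ℕ n → Set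
Adjacent {n} π ρ =
  ¬ BeginsWith π n × ¬ BeginsWith ρ n ×
  ¬ EndsWith π 1 × ¬ EndsWith ρ 1 ×
  SwapOf π ρ

-- A leader permutation is determined by its letter at any single position:
-- letter plus position equals either k or n + k, and these ranges are disjoint
-- for 2 ≤ k ≤ n.  A permutation adjacent to both π and ψ agrees with each of
-- them outside two positions, so when n ≥ 5 some position is left where π and
-- ψ carry the same letter, forcing π = ψ.
module Submission where

open import Defs
open import Data.Nat using (ℕ; _+_; _∸_; _≤_; _<_; z≤n; s≤s)
open import Data.Nat.Properties
  using (_<?_; ≮⇒≥; <⇒≤; <⇒≢; ≤-trans; ≤-<-trans; m<m+n; m≤m+n; m∸n+n≡m; +-comm; +-cancelˡ-≡)
open import Data.Fin as Fin using (Fin; toℕ; _≟_)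
open import Data.Fin.Properties as Finₚ using (toℕ<n; all?; ¬∀⟶∃¬; pigeonhole)
open import Data.List as List using (List; []; _∷_; length)
open import Data.List.Membership.Propositional using (_∈_; _∉_)
open import Data.List.Relation.Unary.Any using (here; there; index)
open import Data.List.Relation.Unary.Any.Properties using (lookup-index)
open import Data.Vec using (Vec; lookup; _[_]≔_)
open import Data.Vec.Properties using (lookup∘update′)
open import Data.Vec.Relation.Binary.Pointwise.Extensional using (ext; Pointwise-≡⇒≡)
open import Data.Product using (∃; ∃₂; _×_; _,_; proj₁; proj₂)
open import Data.Sum using (_⊎_; inj₁; inj₂)
open import Function using (_∘_)
open import Data.Empty using (⊥; ⊥-elim)
open import Relation.Nullary using (yes; no)
open import Relation.Binary.PropositionalEquality
  using (_≡_; _≢_; refl; sym; trans; cong; subst)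

module _ {n : ℕ} where
  open import Data.List.Membership.DecPropositional (_≟_ {n}) using (_∈?_)

  ∃∉ : (xs : List (Fin n)) → length xs < n → ∃ λ p → p ∉ xs
  ∃∉ xs |xs|<n with all? (λ (p : Fin n) → p ∈? xs)
  ... | no ¬all∈ = ¬∀⟶∃¬ n (_∈ xs) (_∈? xs) ¬all∈
  ... | yes all∈ = ⊥-elim (index-collision (pigeonhole |xs|<n (λ p → index (all∈ p))))
    where
    index-collision : ∃₂ (λ p q → p Fin.< q × index (all∈ p) ≡ index (all∈ q)) → ⊥
    index-collision (p , q , p<q , same-index) =
      Finₚ.<⇒≢ p<q (trans (lookup-index (all∈ p))
                     (trans (cong (List.lookup xs) same-index) (sym (lookup-index (all∈ q)))))

swap-fixes : {A : Set} {n : ℕ} (v : Vec A n) {i j p : Fin n} → p ≢ i → p ≢ j →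
             lookup ((v [ i ]≔ lookup v j) [ j ]≔ lookup v i) p ≡ lookup v p
swap-fixes v {i} {j} p≢i p≢j =
  trans (lookup∘update′ p≢j (v [ i ]≔ lookup v j) (lookup v i))
        (lookup∘update′ p≢i v (lookup v j))

swapOf-agrees-off : {n : ℕ} {ρ π : Vec ℕ n} → SwapOf ρ π →
                    ∃₂ λ i j → (p : Fin n) → p ≢ i → p ≢ j → lookup ρ p ≡ lookup π p
swapOf-agrees-off {π = π} (i , j , _ , _ , _ , refl) = i , j , λ _ → swap-fixes π

position : {n : ℕ} → Fin n → ℕ
position i = toℕ i + 1

position≤n : {n : ℕ} (i : Fin n) → position i ≤ n
position≤n {n} i = subst (_≤ n) (+-comm 1 (toℕ i)) (toℕ<n i)

LeaderShape : (n k : ℕ) → Vec ℕ n → Set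
LeaderShape n k a = (i : Fin n) →
  (position i < k → lookup a i ≡ k ∸ position i) ×
  (k ≤ position i → lookup a i ≡ n + k ∸ position i)

leaderShape-unique : {n k : ℕ} {a b : Vec ℕ n} → LeaderShape n k a → LeaderShape n k b → a ≡ b
leaderShape-unique {n} {k} {a} {b} shape-a shape-b = Pointwise-≡⇒≡ (ext agree)
  where
  agree : (i : Fin n) → lookup a i ≡ lookup b i
  agree i with position i <? k
  ... | yes before = trans (proj₁ (shape-a i) before) (sym (proj₁ (shape-b i) before))
  ... | no ¬before = trans (proj₂ (shape-a i) (≮⇒≥ ¬before)) (sym (proj₂ (shape-b i) (≮⇒≥ ¬before)))

leaderShape-letter+position : {n k : ℕ} {a : Vec ℕ n} → LeaderShape n k a → (i : Fin n) →
  lookup a i + position i ≡ k ⊎ lookup a i + position i ≡ n + k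
leaderShape-letter+position {n} {k} shape i with position i <? k
... | yes before rewrite proj₁ (shape i) before = inj₁ (m∸n+n≡m (<⇒≤ before))
... | no ¬before rewrite proj₂ (shape i) (≮⇒≥ ¬before) =
  inj₂ (m∸n+n≡m (≤-trans (position≤n i) (m≤m+n n k)))

n+k≢k′ : {n k k′ : ℕ} → 0 < k → k′ ≤ n → n + k ≢ k′
n+k≢k′ {n} 0<k k′≤n e = <⇒≢ (≤-<-trans k′≤n (m<m+n n 0<k)) (sym e)

parameter-unique : {n k k′ s : ℕ} → 0 < k → k ≤ n → 0 < k′ → k′ ≤ n →
                   s ≡ k ⊎ s ≡ n + k → s ≡ k′ ⊎ s ≡ n + k′ → k ≡ k′
parameter-unique _   _   _    _    (inj₁ e) (inj₁ e′) = trans (sym e) e′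
parameter-unique _   k≤n 0<k′ _    (inj₁ e) (inj₂ e′) = ⊥-elim (n+k≢k′ 0<k′ k≤n (trans (sym e′) e))
parameter-unique 0<k _   _    k′≤n (inj₂ e) (inj₁ e′) = ⊥-elim (n+k≢k′ 0<k k′≤n (trans (sym e) e′))
parameter-unique {n} _ _ _    _    (inj₂ e) (inj₂ e′) = +-cancelˡ-≡ n _ _ (trans (sym e) e′)

leader-determined-by-letter : {n : ℕ} {a b : Vec ℕ n} → IsLeader a → IsLeader b →
                              (i : Fin n) → lookup a i ≡ lookup b i → a ≡ b
leader-determined-by-letter {a = a} {b}
  (_ , k , 2≤k , k≤n , shape-a) (_ , k′ , 2≤k′ , k′≤n , shape-b) i a≡b
  with refl ← parameter-unique (≤-trans (s≤s z≤n) 2≤k) k≤n (≤-trans (s≤s z≤n) 2≤k′) k′≤n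
                 (subst (λ x → x + position i ≡ k ⊎ x + position i ≡ _ + k) a≡b
                        (leaderShape-letter+position {a = a} shape-a i))
                 (leaderShape-letter+position {a = b} shape-b i)
  = leaderShape-unique {a = a} {b} shape-a shape-b

lemma14 : (n : ℕ) → 7 ≤ n → (π ψ : Vec ℕ n) → IsLeader π → IsLeader ψ → π ≢ ψ →
          (ρ : Vec ℕ n) → IsPerm ρ → Adjacent ρ π → Adjacent ρ ψ → ⊥
lemma14 n 7≤n π ψ leader-π leader-ψ π≢ψ ρ _ (_ , _ , _ , _ , ρ-swaps-π) (_ , _ , _ , _ , ρ-swaps-ψ)
  with i , j , ρ≈π ← swapOf-agrees-off ρ-swaps-π
     | i′ , j′ , ρ≈ψ ← swapOf-agrees-off ρ-swaps-ψ
  with p , p∉ ← ∃∉ (i ∷ j ∷ i′ ∷ j′ ∷ []) (≤-trans (s≤s (s≤s (s≤s (s≤s (s≤s z≤n))))) 7≤n)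
  = π≢ψ (leader-determined-by-letter leader-π leader-ψ p
          (trans (sym (ρ≈π p (p∉ ∘ here) (p∉ ∘ there ∘ here)))
                 (ρ≈ψ p (p∉ ∘ there ∘ there ∘ here) (p∉ ∘ there ∘ there ∘ there ∘ here))))
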